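{- Let $k\ge 2$ be an integer and let $T$ be a tree. Then there exist sets $V_1,\ldots,V_t$ with $V(T)=V_1\cup V_2\cup\dots\cup V_t$ and $t\le\lceil\frac{v(T)}{k-1}\rceil+1$ such that (i) $T[V_i]$ is a tree for every $i\in[t]$, and (ii) $|V_i|<2k$ for every $i\in[t]$.
   Context: $v(T)$ is the number of vertices of $T$; $T[X]$ denotes the subgraph of $T$ induced by $X$; $[t]=\{1,\dots,t\}$. -}

module Defs where

open import Level using (Level; 0ℓ) renaming (suc to lsuc)
open import Data.Nat using (ℕ; zero; suc; _+_; _/_; _≤_; _<_)
open import Data.Fin using (Fin)
open import Data.Fin.Subset using (Subset; _∈_)
open import Data.List using (List; []; _∷_; length; _++_)
open import Data.List.Relation.Unary.All using (All)
open import Data.List.Relation.Unary.Linked using (Linked)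
open import Data.List.Relation.Unary.Unique.Propositional using (Unique)
open import Data.Product using (Σ; _×_; ∃)
open import Data.Empty using (⊥)
open import Relation.Nullary using (¬_)
open import Relation.Binary.PropositionalEquality using (_≡_)

record Graph (n : ℕ) : Set₁ where
  field
    Adj     : Fin n → Fin n → Set
    sym     : ∀ {u v} → Adj u v → Adj v u
    irrefl  : ∀ {u} → ¬ Adj u u
open Graph public

data WalkIn {n : ℕ} (G : Graph n) (X : Subset n) : Fin n → Fin n → Set where
  here : ∀ {u} → u ∈ X → WalkIn G X u u
  step : ∀ {u w v} → u ∈ X → Adj G u w → WalkIn G X w v → WalkIn G X u v

record CycleIn {n : ℕ} (G : Graph n) (X : Subset n) : Set where
  field
    first    : Fin n
    rest     : List (Fin n)
    long     : 3 ≤ length (first ∷ rest)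
    distinct : Unique (first ∷ rest)
    inX      : All (_∈ X) (first ∷ rest)
    closedPath : Linked (Adj G) ((first ∷ rest) ++ (first ∷ []))

record IsTreeOn {n : ℕ} (G : Graph n) (X : Subset n) : Set where
  field
    nonempty  : ∃ λ v → v ∈ X
    connected : ∀ {u v} → u ∈ X → v ∈ X → WalkIn G X u v
    acyclic   : ¬ CycleIn G X

IsTree : {n : ℕ} → Graph n → Set
IsTree {n} G = IsTreeOn G Data.Fin.Subset.⊤

-- ⌈ n / d ⌉ for d ≥ 1 (value at d = 0 is irrelevant and set to 0).
⌈_/_⌉ : ℕ → ℕ → ℕ
⌈ n / zero ⌉ = 0
⌈ n / suc m ⌉ = (n + m) / suc m

-- A connected graph on n vertices has a walk through every vertex with at most 2n − 2 steps:
-- starting from one vertex, repeatedly make a detour u → x → u to an unvisited neighbour x,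
-- which costs two steps per new vertex. Cutting this walk into consecutive pieces of
-- 2(k − 1) steps gives at most ⌈n/(k − 1)⌉ pieces, each with at most 2k − 1 vertices, and in
-- a tree the vertex set of any walk induces a subtree.

module Submission where

open import Defs
open import Data.Nat using (ℕ; _+_; _*_; _∸_; _≤_; _<_)
open import Data.Fin using (Fin)
open import Data.Fin.Subset using (Subset; _∈_; ∣_∣)
open import Data.Product using (Σ; _×_; ∃)

open import Data.Nat using (zero; suc; z≤n; s≤s; NonZero; _≤?_)
open import Data.Nat.Properties
open import Data.Nat.DivMod using (_/_; m*n/n≡m; /-monoˡ-≤)
open import Data.Nat.Tactic.RingSolver using (solve-∀)
open import Data.Fin.Properties using (all?; ¬∀⟶∃¬)
open import Data.Fin.Subset using (_⊆_; _⊂_; _∪_; ⁅_⁆; ⊤; inside; outside) renaming (⊥ to ∅)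
open import Data.Fin.Subset.Properties
  using (∣p∣≤n; ∣p∣≤∣p∪q∣; ∣⁅x⁆∣≡1; ∣⊥∣≡0; p⊂q⇒∣p∣<∣q∣; x∈p∪q⁺; x∈p∪q⁻; x∈⁅x⁆; x∈⁅y⁆⇒x≡y; ∉⊥; ∈⊤)
open import Data.Vec using ([]; _∷_)
open import Data.List using (List; []; _∷_; length; lookup)
open import Data.List.Membership.Propositional using () renaming (_∈_ to _∈ₗ_; _∉_ to _∉ₗ_)
open import Data.List.Membership.Propositional.Properties using (∈-lookup)
open import Data.List.Relation.Unary.Any using (Any; here; there; index)
open import Data.List.Relation.Unary.Any.Properties using (lookup-index)
open import Data.List.Relation.Unary.All as All using (All; []; _∷_)
open import Data.Product using (_,_; proj₁; proj₂; ∃₂)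
open import Data.Sum using (_⊎_; inj₁; inj₂)
open import Data.Empty using (⊥-elim)
open import Relation.Nullary using (¬_; yes; no)
open import Relation.Binary.PropositionalEquality as ≡ using (_≡_; refl; cong)

∣p∪q∣≤∣p∣+∣q∣ : ∀ {n} (p q : Subset n) → ∣ p ∪ q ∣ ≤ ∣ p ∣ + ∣ q ∣
∣p∪q∣≤∣p∣+∣q∣ [] [] = z≤n
∣p∪q∣≤∣p∣+∣q∣ (inside ∷ p) (inside ∷ q) =
  s≤s (≤-trans (∣p∪q∣≤∣p∣+∣q∣ p q) (+-monoʳ-≤ ∣ p ∣ (n≤1+n ∣ q ∣)))
∣p∪q∣≤∣p∣+∣q∣ (inside ∷ p) (outside ∷ q) = s≤s (∣p∪q∣≤∣p∣+∣q∣ p q)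
∣p∪q∣≤∣p∣+∣q∣ (outside ∷ p) (inside ∷ q) =
  ≤-trans (s≤s (∣p∪q∣≤∣p∣+∣q∣ p q)) (≤-reflexive (≡.sym (+-suc ∣ p ∣ ∣ q ∣)))
∣p∪q∣≤∣p∣+∣q∣ (outside ∷ p) (outside ∷ q) = ∣p∪q∣≤∣p∣+∣q∣ p q

fromList : ∀ {n} → List (Fin n) → Subset n
fromList [] = ∅
fromList (x ∷ xs) = ⁅ x ⁆ ∪ fromList xs

∈fromList⁺ : ∀ {n} {x : Fin n} {xs} → x ∈ₗ xs → x ∈ fromList xs
∈fromList⁺ (here refl) = x∈p∪q⁺ (inj₁ (x∈⁅x⁆ _))
∈fromList⁺ (there x∈xs) = x∈p∪q⁺ (inj₂ (∈fromList⁺ x∈xs))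

∈fromList⁻ : ∀ {n} {x : Fin n} xs → x ∈ fromList xs → x ∈ₗ xs
∈fromList⁻ [] x∈∅ = ⊥-elim (∉⊥ x∈∅)
∈fromList⁻ (y ∷ ys) x∈ with x∈p∪q⁻ ⁅ y ⁆ (fromList ys) x∈
... | inj₁ x∈⁅y⁆ = here (x∈⁅y⁆⇒x≡y y x∈⁅y⁆)
... | inj₂ x∈ys = there (∈fromList⁻ ys x∈ys)

∣fromList∣≤length : ∀ {n} (xs : List (Fin n)) → ∣ fromList xs ∣ ≤ length xs
∣fromList∣≤length {n} [] = ≤-reflexive (∣⊥∣≡0 n)
∣fromList∣≤length (x ∷ xs) = begin
  ∣ ⁅ x ⁆ ∪ fromList xs ∣         ≤⟨ ∣p∪q∣≤∣p∣+∣q∣ ⁅ x ⁆ (fromList xs) ⟩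
  ∣ ⁅ x ⁆ ∣ + ∣ fromList xs ∣     ≡⟨ cong (_+ ∣ fromList xs ∣) (∣⁅x⁆∣≡1 x) ⟩
  suc ∣ fromList xs ∣             ≤⟨ s≤s (∣fromList∣≤length xs) ⟩
  suc (length xs)                 ∎
  where open ≤-Reasoning

m*n≤o⇒m≤o/n : ∀ m n o .{{_ : NonZero n}} → m * n ≤ o → m ≤ o / n
m*n≤o⇒m≤o/n m n o m*n≤o = ≤-trans (≤-reflexive (≡.sym (m*n/n≡m m n))) (/-monoˡ-≤ n m*n≤o)

module _ {n : ℕ} (G : Graph n) where
  open import Data.List.Membership.DecPropositional (Data.Fin._≟_ {n}) using () renaming (_∈?_ to _∈ₗ?_)

  _++ᵂ_ : ∀ {X u v w} → WalkIn G X u v → WalkIn G X v w → WalkIn G X u w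
  here _ ++ᵂ q = q
  step u∈X e p ++ᵂ q = step u∈X e (p ++ᵂ q)

  walkIn-start∈ : ∀ {X u v} → WalkIn G X u v → u ∈ X
  walkIn-start∈ (here u∈X) = u∈X
  walkIn-start∈ (step u∈X _ _) = u∈X

  reverseWalkIn : ∀ {X u v} → WalkIn G X u v → WalkIn G X v u
  reverseWalkIn (here u∈X) = here u∈X
  reverseWalkIn (step u∈X e p) = reverseWalkIn p ++ᵂ step (walkIn-start∈ p) (Graph.sym G e) (here u∈X)

  exitEdge : ∀ {X a b} (xs : List (Fin n)) → WalkIn G X a b → a ∈ₗ xs → b ∉ₗ xs →
    ∃₂ λ u x → u ∈ₗ xs × x ∉ₗ xs × Adj G u x
  exitEdge xs (here _) a∈xs b∉xs = ⊥-elim (b∉xs a∈xs)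
  exitEdge xs (step {w = x} _ e p) a∈xs b∉xs with x ∈ₗ? xs
  ... | yes x∈xs = exitEdge xs p x∈xs b∉xs
  ... | no x∉xs = _ , x , a∈xs , x∉xs , e

  acyclic-⊆ : ∀ {X Y} → X ⊆ Y → ¬ CycleIn G Y → ¬ CycleIn G X
  acyclic-⊆ X⊆Y acyclicY cycle =
    acyclicY record { CycleIn cycle hiding (inX) ; inX = All.map X⊆Y (CycleIn.inX cycle) }

  infixr 5 _∷⟨_⟩_
  data Walk : Fin n → Set where
    [_]    : (a : Fin n) → Walk a
    _∷⟨_⟩_ : (a : Fin n) {b : Fin n} → Adj G a b → Walk b → Walk a

  steps : ∀ {a} → Walk a → ℕ
  steps [ _ ] = 0
  steps (_ ∷⟨ _ ⟩ w) = suc (steps w)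

  -- Splitting off the start vertex makes it the definitional head of vertices w,
  -- so that membership proofs can be matched against here refl for any w.
  vertices laterVertices : ∀ {a} → Walk a → List (Fin n)
  vertices {a} w = a ∷ laterVertices w
  laterVertices [ _ ] = []
  laterVertices (_ ∷⟨ _ ⟩ w) = vertices w

  vertexSet : ∀ {a} → Walk a → Subset n
  vertexSet w = fromList (vertices w)

  length-vertices : ∀ {a} (w : Walk a) → length (vertices w) ≡ suc (steps w)
  length-vertices [ _ ] = refl
  length-vertices (_ ∷⟨ _ ⟩ w) = cong suc (length-vertices w)

  ∣vertexSet∣≤1+steps : ∀ {a} (w : Walk a) → ∣ vertexSet w ∣ ≤ suc (steps w)
  ∣vertexSet∣≤1+steps w = ≤-trans (∣fromList∣≤length (vertices w)) (≤-reflexive (length-vertices w))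

  walkInTo : ∀ {X a u} (w : Walk a) → All (_∈ X) (vertices w) → u ∈ₗ vertices w → WalkIn G X a u
  walkInTo w (a∈X ∷ _) (here refl) = here a∈X
  walkInTo (_ ∷⟨ e ⟩ w) (a∈X ∷ rest) (there u∈w) = step a∈X e (walkInTo w rest u∈w)

  vertexSet-connected : ∀ {a u v} (w : Walk a) → u ∈ vertexSet w → v ∈ vertexSet w →
    WalkIn G (vertexSet w) u v
  vertexSet-connected w u∈w v∈w =
    reverseWalkIn (walkInTo w inW (∈fromList⁻ _ u∈w)) ++ᵂ walkInTo w inW (∈fromList⁻ _ v∈w)
    where
      inW : All (_∈ vertexSet w) (vertices w)
      inW = All.tabulate ∈fromList⁺

  vertexSet-isTree : ¬ CycleIn G ⊤ → ∀ {a} (w : Walk a) → IsTreeOn G (vertexSet w)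
  vertexSet-isTree acyclic {a} w = record
    { nonempty  = a , ∈fromList⁺ {xs = vertices w} (here refl)
    ; connected = vertexSet-connected w
    ; acyclic   = acyclic-⊆ (λ _ → ∈⊤) acyclic
    }

  detour : ∀ {a u x} (w : Walk a) → u ∈ₗ vertices w → Adj G u x → Walk a
  detour {a} w (here refl) e = a ∷⟨ e ⟩ _ ∷⟨ Graph.sym G e ⟩ w
  detour (a ∷⟨ e′ ⟩ w) (there u∈w) e = a ∷⟨ e′ ⟩ detour w u∈w e

  steps-detour : ∀ {a u x} (w : Walk a) (u∈w : u ∈ₗ vertices w) (e : Adj G u x) →
    steps (detour w u∈w e) ≡ 2 + steps w
  steps-detour w (here refl) e = refl
  steps-detour (_ ∷⟨ _ ⟩ w) (there u∈w) e = cong suc (steps-detour w u∈w e)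

  detour-visits : ∀ {a u x} (w : Walk a) (u∈w : u ∈ₗ vertices w) (e : Adj G u x) →
    x ∈ₗ vertices (detour w u∈w e)
  detour-visits w (here refl) e = there (here refl)
  detour-visits (_ ∷⟨ _ ⟩ w) (there u∈w) e = there (detour-visits w u∈w e)

  detour-keeps : ∀ {a u x v} (w : Walk a) (u∈w : u ∈ₗ vertices w) (e : Adj G u x) →
    v ∈ₗ vertices w → v ∈ₗ vertices (detour w u∈w e)
  detour-keeps w (here refl) e v∈w = there (there v∈w)
  detour-keeps (_ ∷⟨ _ ⟩ w) (there u∈w) e (here refl) = here refl
  detour-keeps (_ ∷⟨ _ ⟩ w) (there u∈w) e (there v∈w) = there (detour-keeps w u∈w e v∈w)

  Covering : ∀ {a} → Walk a → Set
  Covering w = ∀ v → v ∈ₗ vertices w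

  covering⊎detour : (∀ u v → WalkIn G ⊤ u v) → ∀ {a} (w : Walk a) →
    Covering w ⊎ Σ (Walk a) λ w′ → steps w′ ≡ 2 + steps w × vertexSet w ⊂ vertexSet w′
  covering⊎detour connected {a} w with all? (λ v → v ∈ₗ? vertices w)
  ... | yes covering = inj₁ covering
  ... | no ¬covering with ¬∀⟶∃¬ n _ (λ v → v ∈ₗ? vertices w) ¬covering
  ... | x , x∉w with exitEdge (vertices w) (connected a x) (here refl) x∉w
  ... | u , y , u∈w , y∉w , e = inj₂ (detour w u∈w e , steps-detour w u∈w e , grows)
    where
      grows : vertexSet w ⊂ vertexSet (detour w u∈w e)
      grows = (λ v∈w → ∈fromList⁺ (detour-keeps w u∈w e (∈fromList⁻ _ v∈w)))
            , y , ∈fromList⁺ (detour-visits w u∈w e) , λ y∈w → y∉w (∈fromList⁻ _ y∈w)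

  coveringWalk : (∀ u v → WalkIn G ⊤ u v) → (a : Fin n) →
    Σ (Walk a) λ w → Covering w × steps w + 2 ≤ 2 * n
  coveringWalk connected a = grow n [ a ] (m≤m+n n _) balanced-[a]
    where
      Balanced : Walk a → Set
      Balanced w = steps w + 2 ≤ 2 * ∣ vertexSet w ∣

      balanced-[a] : Balanced [ a ]
      balanced-[a] = *-monoʳ-≤ 2 (≤-trans (≤-reflexive (≡.sym (∣⁅x⁆∣≡1 a))) (∣p∣≤∣p∪q∣ ⁅ a ⁆ ∅))

      balanced-detour : ∀ {w w′} → steps w′ ≡ 2 + steps w → vertexSet w ⊂ vertexSet w′ →
        Balanced w → Balanced w′
      balanced-detour {w} {w′} steps≡ w⊂w′ balanced = begin
        steps w′ + 2             ≡⟨ cong (_+ 2) steps≡ ⟩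
        2 + (steps w + 2)        ≤⟨ +-monoʳ-≤ 2 balanced ⟩
        2 + 2 * ∣ vertexSet w ∣  ≡⟨ ≡.sym (*-suc 2 _) ⟩
        2 * suc ∣ vertexSet w ∣  ≤⟨ *-monoʳ-≤ 2 (p⊂q⇒∣p∣<∣q∣ w⊂w′) ⟩
        2 * ∣ vertexSet w′ ∣     ∎
        where open ≤-Reasoning

      grow : (fuel : ℕ) (w : Walk a) → n ≤ fuel + ∣ vertexSet w ∣ → Balanced w →
        Σ (Walk a) λ w → Covering w × steps w + 2 ≤ 2 * n
      grow fuel w enough balanced with covering⊎detour connected w
      grow fuel w _ balanced | inj₁ covering =
        w , covering , ≤-trans balanced (*-monoʳ-≤ 2 (∣p∣≤n (vertexSet w)))
      grow zero w enough _ | inj₂ (w′ , _ , w⊂w′) =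
        ⊥-elim (<⇒≱ (p⊂q⇒∣p∣<∣q∣ w⊂w′) (≤-trans (∣p∣≤n (vertexSet w′)) enough))
      grow (suc fuel) w enough balanced | inj₂ (w′ , steps≡ , w⊂w′) =
        grow fuel w′ enough′ (balanced-detour steps≡ w⊂w′ balanced)
        where
          enough′ : n ≤ fuel + ∣ vertexSet w′ ∣
          enough′ = ≤-trans enough (≤-trans (≤-reflexive (≡.sym (+-suc fuel _)))
                                            (+-monoʳ-≤ fuel (p⊂q⇒∣p∣<∣q∣ w⊂w′)))

  takeWalk : ∀ {a} → ℕ → Walk a → Walk a
  takeWalk zero w = [ _ ]
  takeWalk (suc j) [ a ] = [ a ]
  takeWalk (suc j) (a ∷⟨ e ⟩ w) = a ∷⟨ e ⟩ takeWalk j w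

  dropWalk : ∀ {a} → ℕ → Walk a → ∃ Walk
  dropWalk zero w = _ , w
  dropWalk (suc j) [ a ] = a , [ a ]
  dropWalk (suc j) (_ ∷⟨ _ ⟩ w) = dropWalk j w

  steps-takeWalk : ∀ {a} j (w : Walk a) → steps (takeWalk j w) ≤ j
  steps-takeWalk zero w = z≤n
  steps-takeWalk (suc j) [ _ ] = z≤n
  steps-takeWalk (suc j) (_ ∷⟨ _ ⟩ w) = s≤s (steps-takeWalk j w)

  steps-dropWalk : ∀ {a} j (w : Walk a) → j ≤ steps w → steps (proj₂ (dropWalk j w)) + j ≡ steps w
  steps-dropWalk zero w _ = +-identityʳ _
  steps-dropWalk (suc j) (_ ∷⟨ _ ⟩ w) (s≤s j≤w) =
    ≡.trans (+-suc _ j) (cong suc (steps-dropWalk j w j≤w))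

  ∈takeWalk⊎∈dropWalk : ∀ {a v} j (w : Walk a) → v ∈ₗ vertices w →
    v ∈ₗ vertices (takeWalk j w) ⊎ v ∈ₗ vertices (proj₂ (dropWalk j w))
  ∈takeWalk⊎∈dropWalk zero w v∈w = inj₂ v∈w
  ∈takeWalk⊎∈dropWalk (suc j) [ _ ] v∈w = inj₁ v∈w
  ∈takeWalk⊎∈dropWalk (suc j) (_ ∷⟨ _ ⟩ w) (here refl) = inj₁ (here refl)
  ∈takeWalk⊎∈dropWalk (suc j) (_ ∷⟨ _ ⟩ w) (there v∈w) with ∈takeWalk⊎∈dropWalk j w v∈w
  ... | inj₁ v∈take = inj₁ (there v∈take)
  ... | inj₂ v∈drop = inj₂ v∈drop

  -- Consecutive pieces share their boundary vertex; all but the last have s steps.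
  chunks : (fuel s : ℕ) → ∀ {a} → Walk a → List (∃ Walk)
  chunks zero s w = (_ , w) ∷ []
  chunks (suc fuel) s w with steps w ≤? s
  ... | yes _ = (_ , w) ∷ []
  ... | no _ = (_ , takeWalk s w) ∷ chunks fuel s (proj₂ (dropWalk s w))

  chunks-cover : ∀ fuel s {a v} (w : Walk a) → v ∈ₗ vertices w →
    Any (λ c → v ∈ₗ vertices (proj₂ c)) (chunks fuel s w)
  chunks-cover zero s w v∈w = here v∈w
  chunks-cover (suc fuel) s w v∈w with steps w ≤? s
  ... | yes _ = here v∈w
  ... | no _ with ∈takeWalk⊎∈dropWalk s w v∈w
  ... | inj₁ v∈take = here v∈take
  ... | inj₂ v∈drop = there (chunks-cover fuel s (proj₂ (dropWalk s w)) v∈drop)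

  chunks-short : ∀ fuel s {a} (w : Walk a) → steps w ≤ fuel →
    All (λ c → steps (proj₂ c) ≤ suc s) (chunks fuel (suc s) w)
  chunks-short zero s w w≤0 = ≤-trans w≤0 z≤n ∷ []
  chunks-short (suc fuel) s w w≤fuel with steps w ≤? suc s
  ... | yes w≤s = w≤s ∷ []
  ... | no w≰s = steps-takeWalk (suc s) w ∷ chunks-short fuel s rest rest≤fuel
    where
      rest : Walk (proj₁ (dropWalk (suc s) w))
      rest = proj₂ (dropWalk (suc s) w)

      rest≤fuel : steps rest ≤ fuel
      rest≤fuel = ≤-pred (begin
        suc (steps rest)      ≤⟨ m<m+n (steps rest) (s≤s z≤n) ⟩
        steps rest + suc s    ≡⟨ steps-dropWalk (suc s) w (<⇒≤ (≰⇒> w≰s)) ⟩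
        steps w               ≤⟨ w≤fuel ⟩
        suc fuel              ∎)
        where open ≤-Reasoning

  length-chunks : ∀ fuel s {a} (w : Walk a) → length (chunks fuel s w) * s ≤ steps w + s
  length-chunks zero s w = ≤-trans (≤-reflexive (+-identityʳ s)) (m≤n+m s (steps w))
  length-chunks (suc fuel) s w with steps w ≤? s
  ... | yes _ = ≤-trans (≤-reflexive (+-identityʳ s)) (m≤n+m s (steps w))
  ... | no w≰s = begin
    s + length (chunks fuel s rest) * s  ≤⟨ +-monoʳ-≤ s (length-chunks fuel s rest) ⟩
    s + (steps rest + s)                 ≡⟨ +-comm s _ ⟩
    steps rest + s + s                   ≡⟨ cong (_+ s) (steps-dropWalk s w (<⇒≤ (≰⇒> w≰s))) ⟩
    steps w + s                          ∎
    where
      open ≤-Reasoning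
      rest : Walk (proj₁ (dropWalk s w))
      rest = proj₂ (dropWalk s w)

t*2m≤ℓ+2m⇒t≤⌈n/m⌉ : ∀ t ℓ n j → t * (2 + 2 * j) ≤ ℓ + (2 + 2 * j) → ℓ + 2 ≤ 2 * n →
  t ≤ ⌈ n / suc j ⌉
t*2m≤ℓ+2m⇒t≤⌈n/m⌉ t ℓ n j t*2m≤ℓ+2m ℓ+2≤2n = m*n≤o⇒m≤o/n t (suc j) (n + j) (*-cancelˡ-≤ 2 (begin
  2 * (t * suc j)    ≡⟨ double t j ⟩
  t * (2 + 2 * j)    ≤⟨ t*2m≤ℓ+2m ⟩
  ℓ + (2 + 2 * j)    ≡⟨ ≡.sym (+-assoc ℓ 2 (2 * j)) ⟩
  ℓ + 2 + 2 * j      ≤⟨ +-monoˡ-≤ (2 * j) ℓ+2≤2n ⟩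
  2 * n + 2 * j      ≡⟨ ≡.sym (*-distribˡ-+ 2 n j) ⟩
  2 * (n + j)        ∎))
  where
    open ≤-Reasoning
    double : ∀ t j → 2 * (t * suc j) ≡ t * (2 + 2 * j)
    double = solve-∀

lemma2p11 : (k : ℕ) → 2 ≤ k → (n : ℕ) → (T : Graph n) → IsTree T →
    Σ ℕ λ t → Σ (Fin t → Subset n) λ V →
    (t ≤ ⌈ n / (k ∸ 1) ⌉ + 1)
    × (∀ (v : Fin n) → ∃ λ (i : Fin t) → v ∈ V i)
    × (∀ (i : Fin t) → IsTreeOn T (V i))
    × (∀ (i : Fin t) → ∣ V i ∣ < 2 * k)
lemma2p11 (suc zero) (s≤s ())
lemma2p11 (suc (suc k-2)) _ n T tree = length pieces , V , few , cover , isTree , small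
  where
    open IsTreeOn tree using (nonempty; connected; acyclic)

    root : Fin n
    root = proj₁ nonempty

    tour : Σ (Walk T root) λ w → Covering T w × steps T w + 2 ≤ 2 * n
    tour = coveringWalk T (λ u v → connected ∈⊤ ∈⊤) root

    w : Walk T root
    w = proj₁ tour

    pieces : List (∃ (Walk T))
    pieces = chunks T (steps T w) (2 + 2 * k-2) w

    piece : (i : Fin (length pieces)) → Walk T (proj₁ (lookup pieces i))
    piece i = proj₂ (lookup pieces i)

    V : Fin (length pieces) → Subset n
    V i = vertexSet T (piece i)

    few : length pieces ≤ ⌈ n / suc k-2 ⌉ + 1
    few = ≤-trans (t*2m≤ℓ+2m⇒t≤⌈n/m⌉ (length pieces) (steps T w) n k-2
                     (length-chunks T (steps T w) _ w) (proj₂ (proj₂ tour)))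
                  (m≤m+n _ 1)

    cover : ∀ v → ∃ λ i → v ∈ V i
    cover v = index v∈piece , ∈fromList⁺ (lookup-index v∈piece)
      where
        v∈piece : Any (λ c → v ∈ₗ vertices T (proj₂ c)) pieces
        v∈piece = chunks-cover T (steps T w) _ w (proj₁ (proj₂ tour) v)

    isTree : ∀ i → IsTreeOn T (V i)
    isTree i = vertexSet-isTree T acyclic (piece i)

    small : ∀ i → ∣ V i ∣ < 2 * suc (suc k-2)
    small i = begin-strict
      ∣ V i ∣               ≤⟨ ∣vertexSet∣≤1+steps T (piece i) ⟩
      suc (steps T (piece i))
        ≤⟨ s≤s (All.lookup (chunks-short T (steps T w) (suc (2 * k-2)) w ≤-refl) (∈-lookup i)) ⟩
      3 + 2 * k-2           <⟨ n<1+n _ ⟩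
      4 + 2 * k-2           ≡⟨ ≡.sym (*-distribˡ-+ 2 2 k-2) ⟩
      2 * suc (suc k-2)     ∎
      where open ≤-Reasoning
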